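{- For every $\mu>0$ and $f\in\mathbb{N}$ there exists an integer $m$ such that the following holds. If $\mathcal{A}$ is a $\mu$-dense reduced hypergraph with index set $[m]$, vertex classes $\mathcal{P}^{ij}$ and constituents $\mathcal{A}^{ijk}$, then there are indices $\lambda(1)<\dots<\lambda(f)$ in $[m]$ and, for each pair $1\le r<s\le f$, three vertices $P^{\lambda(r)\lambda(s)}_{\mathrm{red}},P^{\lambda(r)\lambda(s)}_{\mathrm{blue}},P^{\lambda(r)\lambda(s)}_{\mathrm{green}}\in\mathcal{P}^{\lambda(r)\lambda(s)}$ such that for every triple of indices $1\le r<s<t\le f$ the three vertices $P^{\lambda(r)\lambda(s)}_{\mathrm{red}}$, $P^{\lambda(r)\lambda(t)}_{\mathrm{blue}}$, $P^{\lambda(s)\lambda(t)}_{\mathrm{green}}$ form a hyperedge of $\mathcal{A}^{\lambda(r)\lambda(s)\lambda(t)}$.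
   Context: A reduced hypergraph with (finite) index set $I$ is given by: for each pair of distinct indices $i,j\in I$ a finite nonempty vertex class $\mathcal{P}^{ij}=\mathcal{P}^{ji}$, these classes being pairwise disjoint for distinct pairs; and for any three distinct $i,j,k\in I$ a tripartite $3$-uniform hypergraph $\mathcal{A}^{ijk}$ (the constituent, independent of the order of $i,j,k$) with vertex classes $\mathcal{P}^{ij},\mathcal{P}^{ik},\mathcal{P}^{jk}$. The reduced hypergraph $\mathcal{A}$ has vertex set the disjoint union of all $\mathcal{P}^{ij}$ and edge set the disjoint union of all $E(\mathcal{A}^{ijk})$. For $\mu>0$, $\mathcal{A}$ is $\mu$-dense if $|E(\mathcal{A}^{ijk})|\ge\mu\,|\mathcal{P}^{ij}|\,|\mathcal{P}^{ik}|\,|\mathcal{P}^{jk}|$ for every triple $\{i,j,k\}\subseteq I$.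
   Formalization: The density parameter μ ranges over the positive rationals. -}

module Defs where

open import Data.Nat using (ℕ; zero; suc; _+_; _*_)
import Data.Nat as ℕ
open import Data.Fin using (Fin; zero; suc; _<_)
open import Data.Bool using (Bool; true; false)
open import Data.Integer using (+_)
open import Data.Rational using (ℚ; _/_; _≤_; 0ℚ) renaming (_*_ to _*ℚ_; _<_ to _<ℚ_)

sumFin : (n : ℕ) → (Fin n → ℕ) → ℕ
sumFin zero    g = 0
sumFin (suc n) g = g zero + sumFin n (λ x → g (suc x))

count : (n : ℕ) → (Fin n → Bool) → ℕ
count n P = sumFin n (λ x → Data.Bool.if P x then 1 else 0)

ℕ→ℚ : ℕ → ℚ
ℕ→ℚ n = + n / 1

-- For indices i < j the vertex class P^{ij} is Fin (size i j) (classes of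
-- distinct pairs are disjoint by construction; the unordered pair {i,j} is
-- represented by its increasing enumeration (i , j)).
-- For i < j < k the constituent A^{ijk} is the tripartite 3-graph with
-- vertex classes P^{ij}, P^{ik}, P^{jk} whose edges are the triples on which
-- `edge i j k` is true.  Values of `size` / `edge` at non-increasing index
-- tuples are irrelevant junk: never constrained and never used.
record ReducedHypergraph (m : ℕ) : Set where
  field
    size     : Fin m → Fin m → ℕ
    nonempty : ∀ i j → i < j → 0 ℕ.< size i j
    edge     : ∀ i j k → Fin (size i j) → Fin (size i k) → Fin (size j k) → Bool

  edgeCount : Fin m → Fin m → Fin m → ℕ
  edgeCount i j k =
    sumFin (size i j) λ a → sumFin (size i k) λ b → count (size j k) λ c → edge i j k a b c

open ReducedHypergraph public

Dense : (μ : ℚ) → {m : ℕ} → ReducedHypergraph m → Set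
Dense μ {m} A = ∀ (i j k : Fin m) → i < j → j < k →
  μ *ℚ ℕ→ℚ (size A i j * size A i k * size A j k) ≤ ℕ→ℚ (edgeCount A i j k)

module Submission where

-- Proof of the theorem.  From μ > 0 we first extract an integer constant K
-- with |P^{ij}| |P^{ik}| |P^{jk}| ≤ K |E(A^{ijk})| (densityConstant).
--
-- Both phases of the construction are instances of one pivoting scheme
-- (module Pivoting): take the first index e of the current set, attach data
-- to e, and keep only a large set of later indices on which this data is
-- good; after k rounds, k indices remain, each carrying data that is good
-- for all later survivors.  The simplest round picks one vertex of a class
-- P_e that is good for a 1/L fraction of the later indices; such a vertex
-- exists by double counting (averaging), giving the selection lemma
-- (module Selection).
--
-- Phase 1 (green, from the top): for each t and each s < t choose a vertex
-- of P^{st} lying in at least |P^{rs}| |P^{rt}| / 2K edges of A^{rst} for all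
-- surviving r < s; by a Markov-type bound (many-heavy) a 1/2K fraction of
-- P^{st} qualifies.  Phase 2 (red and blue, from the bottom, inside the
-- green set): for each r choose blue vertices of the P^{rt} and then red
-- vertices of the P^{rs} so that every red–blue–green triple is an edge.

open import Defs
open import Data.Nat using (ℕ)
open import Data.Fin using (Fin; _<_)
open import Data.Fin.Properties using (<-trans)
open import Data.Bool using (true)
open import Data.Product using (Σ; ∃; _×_)
open import Data.Rational using (ℚ; 0ℚ) renaming (_<_ to _<ℚ_)
open import Relation.Binary.PropositionalEquality using (_≡_)

open import Data.Nat as ℕ using (zero; suc; _+_; _*_; _≤_; _≤?_; z≤n; s≤s; NonZero; >-nonZero)
open import Data.Nat.Properties
  using ( ≤-refl; ≤-reflexive; ≤-trans; ≤-pred; <⇒≤; <⇒≱; ≰⇒>; n≮0; m≤m+n; m≤n+m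
        ; +-comm; +-identityʳ; +-mono-≤; +-mono-<-≤; +-cancelʳ-≤
        ; *-comm; *-assoc; *-identityʳ; *-zeroʳ; *-monoʳ-≤; *-cancelˡ-≤; m*n≢0
        ; +-*-semiring; module ≤-Reasoning )
import Data.Fin as F
open import Data.Fin using (zero; suc)
open import Data.Fin.Properties using (_≟_; any?; <-asym; ≤∧≢⇒<)
open import Data.Bool using (Bool; false; if_then_else_; _∧_; _∨_; not)
import Data.Bool.Properties as BoolP
open import Data.Product using (_,_; proj₁; proj₂)
open import Data.Sum using (_⊎_; inj₁; inj₂)
import Data.Empty.Irrelevant as Irrelevant
open import Function using (_∘_; flip)
open import Relation.Binary.PropositionalEquality using (_≢_; refl; sym; trans; cong; cong₂; subst; subst₂; module ≡-Reasoning)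
open import Relation.Nullary using (yes; no; ¬_; contradiction; does)
open import Relation.Nullary.Decidable using (⌊_⌋)
open import Algebra.Properties.Semiring.Sum +-*-semiring using (sum; ∑-distrib-+; ∑-comm; *-distribˡ-sum)
open import Data.Integer as ℤ using (+[1+_]; -[1+_])
import Data.Integer.Properties as ℤP
open import Data.Rational using (mkℚ; toℚᵘ; *<*) renaming (_*_ to _*ℚ_; _≤_ to _≤ℚ_)
import Data.Rational.Properties as ℚP
open import Data.Rational.Unnormalised as ℚᵘ using (mkℚᵘ; *≤*)
import Data.Rational.Unnormalised.Properties as ℚᵘP
open import Data.Nat.Coprimality using (1-coprimeTo) renaming (sym to coprime-sym)

sumFin≡sum : ∀ n (g : Fin n → ℕ) → sumFin n g ≡ sum g
sumFin≡sum zero    g = refl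
sumFin≡sum (suc n) g = cong (g zero +_) (sumFin≡sum n (g ∘ suc))

sumFin-cong : ∀ n {f g : Fin n → ℕ} → (∀ x → f x ≡ g x) → sumFin n f ≡ sumFin n g
sumFin-cong zero    f≗g = refl
sumFin-cong (suc n) f≗g = cong₂ _+_ (f≗g zero) (sumFin-cong n (f≗g ∘ suc))

sumFin-mono : ∀ n {f g : Fin n → ℕ} → (∀ x → f x ≤ g x) → sumFin n f ≤ sumFin n g
sumFin-mono zero    f≤g = z≤n
sumFin-mono (suc n) f≤g = +-mono-≤ (f≤g zero) (sumFin-mono n (f≤g ∘ suc))

sumFin-mono-< : ∀ n {f g : Fin n → ℕ} → 0 ℕ.< n → (∀ x → f x ℕ.< g x) → sumFin n f ℕ.< sumFin n g
sumFin-mono-< (suc n) _ f<g = +-mono-<-≤ (f<g zero) (sumFin-mono n (<⇒≤ ∘ f<g ∘ suc))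

sumFin-const : ∀ n c → sumFin n (λ _ → c) ≡ n * c
sumFin-const zero    c = refl
sumFin-const (suc n) c = cong (c +_) (sumFin-const n c)

sumFin-+ : ∀ n (f g : Fin n → ℕ) → sumFin n (λ x → f x + g x) ≡ sumFin n f + sumFin n g
sumFin-+ n f g = begin
  sumFin n (λ x → f x + g x)  ≡⟨ sumFin≡sum n _ ⟩
  sum (λ x → f x + g x)       ≡⟨ ∑-distrib-+ f g ⟩
  sum f + sum g               ≡⟨ sym (cong₂ _+_ (sumFin≡sum n f) (sumFin≡sum n g)) ⟩
  sumFin n f + sumFin n g     ∎
  where open ≡-Reasoning

sumFin-*ˡ : ∀ n c (f : Fin n → ℕ) → c * sumFin n f ≡ sumFin n (λ x → c * f x)
sumFin-*ˡ n c f = begin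
  c * sumFin n f              ≡⟨ cong (c *_) (sumFin≡sum n f) ⟩
  c * sum f                   ≡⟨ *-distribˡ-sum c f ⟩
  sum (λ x → c * f x)         ≡⟨ sym (sumFin≡sum n _) ⟩
  sumFin n (λ x → c * f x)    ∎
  where open ≡-Reasoning

sumFin-comm : ∀ n k (f : Fin n → Fin k → ℕ) →
  sumFin n (λ x → sumFin k (f x)) ≡ sumFin k (λ y → sumFin n (λ x → f x y))
sumFin-comm n k f = begin
  sumFin n (λ x → sumFin k (f x))           ≡⟨ sumFin-cong n (λ x → sumFin≡sum k (f x)) ⟩
  sumFin n (λ x → sum (f x))                ≡⟨ sumFin≡sum n _ ⟩
  sum (λ x → sum (f x))                     ≡⟨ ∑-comm f ⟩
  sum (λ y → sum (λ x → f x y))             ≡⟨ sym (sumFin≡sum k _) ⟩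
  sumFin k (λ y → sum (λ x → f x y))        ≡⟨ sym (sumFin-cong k (λ y → sumFin≡sum n _)) ⟩
  sumFin k (λ y → sumFin n (λ x → f x y))   ∎
  where open ≡-Reasoning

-- Subsets of Fin m are Boolean predicates, so that they can be counted.
infix 4 _∈_ _⊆_
infixl 6 _-_

Subset : ℕ → Set
Subset m = Fin m → Bool

_∈_ : ∀ {m} → Fin m → Subset m → Set
x ∈ S = S x ≡ true

_⊆_ : ∀ {m} → Subset m → Subset m → Set
S ⊆ T = ∀ x → x ∈ S → x ∈ T

∣_∣ : ∀ {m} → Subset m → ℕ
∣_∣ {m} S = count m S

_==_ : ∀ {m} → Fin m → Fin m → Bool
x == e = does (x ≟ e)

_-_ : ∀ {m} → Subset m → Fin m → Subset m
(S - e) x = S x ∧ not (x == e)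

insert : ∀ {m} → Fin m → Subset m → Subset m
insert e S x = S x ∨ x == e

𝟙 : Bool → ℕ
𝟙 b = if b then 1 else 0

count-≤ : ∀ n (P : Fin n → Bool) → count n P ≤ n
count-≤ zero    P = z≤n
count-≤ (suc n) P = +-mono-≤ (𝟙≤1 (P zero)) (count-≤ n (P ∘ suc))
  where
  𝟙≤1 : ∀ b → 𝟙 b ≤ 1
  𝟙≤1 true  = ≤-refl
  𝟙≤1 false = z≤n

count-all : ∀ n → count n (λ _ → true) ≡ n
count-all zero    = refl
count-all (suc n) = cong suc (count-all n)

count-none : ∀ n → count n (λ _ → false) ≡ 0
count-none zero    = refl
count-none (suc n) = count-none n

count-singleton : ∀ {n} (e : Fin n) → count n (_== e) ≡ 1
count-singleton {suc n} zero    = cong suc (count-none n)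
count-singleton {suc n} (suc e) = count-singleton e

count-witness : ∀ {n} (S : Subset n) → 0 ℕ.< ∣ S ∣ → Σ (Fin n) λ x → x ∈ S
count-witness {suc n} S pos with S zero in S0
... | true  = zero , S0
... | false = let (x , x∈S) = count-witness (S ∘ suc) pos in suc x , x∈S

count-remove : ∀ {m} (S : Subset m) e → ∣ S ∣ ≤ suc ∣ S - e ∣
count-remove {m} S e = begin
  ∣ S ∣                                    ≤⟨ sumFin-mono m split ⟩
  sumFin m (λ x → 𝟙 ((S - e) x) + 𝟙 (x == e)) ≡⟨ sumFin-+ m _ _ ⟩
  ∣ S - e ∣ + count m (_== e)               ≡⟨ cong (∣ S - e ∣ +_) (count-singleton e) ⟩
  ∣ S - e ∣ + 1                             ≡⟨ +-comm _ 1 ⟩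
  suc ∣ S - e ∣                             ∎
  where
  open ≤-Reasoning
  split : ∀ x → 𝟙 (S x) ≤ 𝟙 ((S - e) x) + 𝟙 (x == e)
  split x with S x | x == e
  ... | true  | true  = ≤-refl
  ... | true  | false = ≤-refl
  ... | false | _     = z≤n

count-insert : ∀ {m} (S : Subset m) e → ¬ e ∈ S → ∣ insert e S ∣ ≡ suc ∣ S ∣
count-insert {m} S e e∉S = begin
  ∣ insert e S ∣                         ≡⟨ sumFin-cong m split ⟩
  sumFin m (λ x → 𝟙 (S x) + 𝟙 (x == e))  ≡⟨ sumFin-+ m _ _ ⟩
  ∣ S ∣ + count m (_== e)                ≡⟨ cong (∣ S ∣ +_) (count-singleton e) ⟩
  ∣ S ∣ + 1                              ≡⟨ +-comm _ 1 ⟩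
  suc ∣ S ∣                              ∎
  where
  open ≡-Reasoning
  split : ∀ x → 𝟙 (insert e S x) ≡ 𝟙 (S x) + 𝟙 (x == e)
  split x with x ≟ e | S x in Sx
  ... | yes refl | true  = contradiction Sx e∉S
  ... | yes refl | false = refl
  ... | no _     | true  = refl
  ... | no _     | false = refl

∈-insert⁻ : ∀ {m} (S : Subset m) e x → x ∈ insert e S → x ∈ S ⊎ x ≡ e
∈-insert⁻ S e x x∈ with S x | x ≟ e
... | true  | _       = inj₁ refl
... | false | yes x≡e = inj₂ x≡e

∈-insert-here : ∀ {m} (S : Subset m) e → e ∈ insert e S
∈-insert-here S e with S e | e ≟ e
... | true  | _  = refl
... | false | yes _   = refl
... | false | no e≢e = contradiction refl e≢e

∈-insert-there : ∀ {m} (S : Subset m) e x → x ∈ S → x ∈ insert e S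
∈-insert-there S e x x∈S rewrite x∈S = refl

∈-remove⁻ : ∀ {m} (S : Subset m) e x → x ∈ S - e → x ∈ S × x ≢ e
∈-remove⁻ S e x x∈ with S x | x ≟ e
... | true | no x≢e = refl , x≢e


pigeonhole : ∀ n (a : Fin n → ℕ) b → 0 ℕ.< n → n * b ≤ sumFin n a → Σ (Fin n) λ v → b ≤ a v
pigeonhole n a b n>0 n*b≤∑a with any? (λ v → b ≤? a v)
... | yes found = found
... | no  none  = contradiction n*b≤∑a (<⇒≱ ∑a<n*b)
  where
  ∑a<n*b : sumFin n a ℕ.< n * b
  ∑a<n*b = subst (sumFin n a ℕ.<_) (sumFin-const n b)
             (sumFin-mono-< n n>0 (λ v → ≰⇒> (λ b≤av → none (v , b≤av))))

averaging : ∀ {n M} L → 0 ℕ.< n → (C : Subset M) (G : Fin n → Fin M → Bool) →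
  (∀ c → c ∈ C → n ≤ L * count n (λ v → G v c)) →
  Σ (Fin n) λ v → ∣ C ∣ ≤ L * count M (λ c → C c ∧ G v c)
averaging {n} {M} L n>0 C G dense = pigeonhole n (λ v → L * count M (λ c → C c ∧ G v c)) ∣ C ∣ n>0 doubleCount
  where
  open ≤-Reasoning
  atPoint : ∀ c → n * 𝟙 (C c) ≤ L * sumFin n (λ v → 𝟙 (C c ∧ G v c))
  atPoint c with C c | dense c
  ... | true  | dense-c = subst (_≤ L * count n (λ v → G v c)) (sym (*-identityʳ n)) (dense-c refl)
  ... | false | _       = ≤-reflexive (trans (*-zeroʳ n) (sym (trans (cong (L *_) (count-none n)) (*-zeroʳ L))))
  doubleCount : n * ∣ C ∣ ≤ sumFin n (λ v → L * count M (λ c → C c ∧ G v c))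
  doubleCount = begin
    n * ∣ C ∣                                                   ≡⟨ sumFin-*ˡ M n _ ⟩
    sumFin M (λ c → n * 𝟙 (C c))                                ≤⟨ sumFin-mono M atPoint ⟩
    sumFin M (λ c → L * sumFin n (λ v → 𝟙 (C c ∧ G v c)))        ≡⟨ sumFin-cong M (λ c → sumFin-*ˡ n L _) ⟩
    sumFin M (λ c → sumFin n (λ v → L * 𝟙 (C c ∧ G v c)))        ≡⟨ sumFin-comm M n _ ⟩
    sumFin n (λ v → sumFin M (λ c → L * 𝟙 (C c ∧ G v c)))        ≡⟨ sumFin-cong n (λ v → sym (sumFin-*ˡ M L _)) ⟩
    sumFin n (λ v → L * count M (λ c → C c ∧ G v c))            ∎

many-heavy : ∀ n (w : Fin n → ℕ) B c → .{{NonZero B}} → (∀ y → w y ≤ B) →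
  B * n ≤ c * sumFin n w → n ≤ (2 * c) * count n (λ y → ⌊ B ≤? (2 * c) * w y ⌋)
many-heavy n w B c w≤B avg = *-cancelˡ-≤ B (+-cancelʳ-≤ (n * B) (B * n) _ (begin
    B * n + n * B                             ≡⟨ cong (B * n +_) (*-comm n B) ⟩
    B * n + B * n                             ≡⟨ cong (B * n +_) (sym (+-identityʳ (B * n))) ⟩
    2 * (B * n)                               ≤⟨ *-monoʳ-≤ 2 avg ⟩
    2 * (c * sumFin n w)                      ≡⟨ sym (*-assoc 2 c _) ⟩
    (2 * c) * sumFin n w                      ≡⟨ sumFin-*ˡ n (2 * c) w ⟩
    sumFin n (λ y → (2 * c) * w y)            ≤⟨ sumFin-mono n atPoint ⟩
    sumFin n (λ y → (2 * c) * B * 𝟙 (heavy y) + B)  ≡⟨ sumFin-+ n _ _ ⟩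
    sumFin n (λ y → (2 * c) * B * 𝟙 (heavy y)) + sumFin n (λ _ → B)
                                              ≡⟨ cong₂ _+_ (sym (sumFin-*ˡ n ((2 * c) * B) (𝟙 ∘ heavy))) (sumFin-const n B) ⟩
    (2 * c) * B * count n heavy + n * B       ≡⟨ cong (_+ n * B) (cong (_* count n heavy) (*-comm (2 * c) B)) ⟩
    B * (2 * c) * count n heavy + n * B       ≡⟨ cong (_+ n * B) (*-assoc B (2 * c) _) ⟩
    B * ((2 * c) * count n heavy) + n * B     ∎))
  where
  open ≤-Reasoning
  heavy : Fin n → Bool
  heavy y = ⌊ B ≤? (2 * c) * w y ⌋
  atPoint : ∀ y → (2 * c) * w y ≤ (2 * c) * B * 𝟙 (heavy y) + B
  atPoint y with B ≤? (2 * c) * w y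
  ... | yes _     = ≤-trans (*-monoʳ-≤ (2 * c) (w≤B y)) (≤-trans (≤-reflexive (sym (*-identityʳ _))) (m≤m+n _ B))
  ... | no  light = ≤-trans (<⇒≤ (≰⇒> light)) (m≤n+m B _)

least : ∀ {m} (S : Subset m) {x} → x ∈ S → Σ (Fin m) λ e → e ∈ S × (∀ c → c ∈ S → e F.≤ c)
least {suc m} S {x} x∈S with S zero in S0
... | true  = zero , S0 , λ _ _ → z≤n
... | false = let (y , y∈S)      = tail x x∈S
                  (e , e∈S , e≤) = least (S ∘ suc) y∈S in
              suc e , e∈S , λ { zero 0∈S → contradiction (trans (sym 0∈S) S0) λ () ; (suc c) c∈S → s≤s (e≤ c c∈S) }
  where
  tail : ∀ x → x ∈ S → Σ (Fin m) λ y → suc y ∈ S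
  tail zero    0∈S = contradiction (trans (sym 0∈S) S0) λ ()
  tail (suc y) y∈S = y , y∈S

greatest : ∀ {m} (S : Subset m) {x} → x ∈ S → Σ (Fin m) λ e → e ∈ S × (∀ c → c ∈ S → c F.≤ e)
greatest {suc m} S {x} x∈S with any? (λ y → S (suc y) BoolP.≟ true)
... | yes (y , y∈S) = let (e , e∈S , ≤e) = greatest (S ∘ suc) y∈S in
                      suc e , e∈S , λ { zero _ → z≤n ; (suc c) c∈S → s≤s (≤e c c∈S) }
... | no  noTail    = zero , head x x∈S , λ { zero _ → z≤n ; (suc c) c∈S → contradiction (c , c∈S) noTail }
  where
  head : ∀ x → x ∈ S → zero ∈ S
  head zero    0∈S = 0∈S
  head (suc y) y∈S = contradiction (y , y∈S) noTail

enumerate : ∀ {m} f (X : Subset m) → f ≤ ∣ X ∣ →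
  Σ (Fin f → Fin m) λ g → (∀ r s → r < s → g r < g s) × (∀ r → g r ∈ X)
enumerate     zero    X _ = (λ ()) , (λ ()) , (λ ())
enumerate {zero}  (suc f) X ()
enumerate {suc m} (suc f) X big with X zero in X0
... | true  with enumerate f (X ∘ suc) (≤-pred big)
...   | g , increasing , g∈X = g⁺ , increasing⁺ , g⁺∈X
  where
  g⁺ : Fin (suc f) → Fin (suc m)
  g⁺ zero    = zero
  g⁺ (suc r) = suc (g r)
  increasing⁺ : ∀ r s → r < s → g⁺ r < g⁺ s
  increasing⁺ zero    (suc s) _         = s≤s z≤n
  increasing⁺ (suc r) (suc s) (s≤s r<s) = s≤s (increasing r s r<s)
  g⁺∈X : ∀ r → g⁺ r ∈ X
  g⁺∈X zero    = X0
  g⁺∈X (suc r) = g∈X r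
enumerate {suc m} (suc f) X big | false with enumerate (suc f) (X ∘ suc) big
... | g , increasing , g∈X = suc ∘ g , (λ r s r<s → s≤s (increasing r s r<s)) , g∈X

record PivotOrder (m : ℕ) : Set₁ where
  field
    _◁_    : Fin m → Fin m → Set
    ◁-asym : ∀ {x y} → x ◁ y → ¬ y ◁ x
    pivot  : (S : Subset m) {x : Fin m} → x ∈ S →
             Σ (Fin m) λ e → e ∈ S × (∀ c → c ∈ S → c ≢ e → e ◁ c)

ascending : ∀ {m} → PivotOrder m
ascending = record
  { _◁_    = _<_
  ; ◁-asym = <-asym
  ; pivot  = λ S x∈S → let (e , e∈S , e≤) = least S x∈S in
                       e , e∈S , λ c c∈S c≢e → ≤∧≢⇒< (e≤ c c∈S) (c≢e ∘ sym)
  }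

descending : ∀ {m} → PivotOrder m
descending = record
  { _◁_    = flip _<_
  ; ◁-asym = <-asym
  ; pivot  = λ S x∈S → let (e , e∈S , ≤e) = greatest S x∈S in
                       e , e∈S , λ c c∈S c≢e → ≤∧≢⇒< (≤e c c∈S) c≢e
  }

Pick : ℕ → Set
Pick n = .(0 ℕ.< n) → Fin n

anyVertex : ∀ {n} → Pick n
anyVertex {zero}  0<0 = Irrelevant.⊥-elim (n≮0 0<0)
anyVertex {suc n} _   = zero

update : ∀ {m} {B : Fin m → Set} → ((x : Fin m) → B x) → (e : Fin m) → B e → (x : Fin m) → B x
update f e b x with x ≟ e
... | yes refl = b
... | no  _    = f x

update-≡ : ∀ {m} {B : Fin m → Set} (f : (x : Fin m) → B x) e b → update f e b e ≡ b
update-≡ f e b with e ≟ e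
... | yes refl = refl
... | no  e≢e  = contradiction refl e≢e

update-≢ : ∀ {m} {B : Fin m → Set} (f : (x : Fin m) → B x) e b {x} → x ≢ e → update f e b x ≡ f x
update-≢ f e b {x} x≢e with x ≟ e
... | yes x≡e = contradiction x≡e x≢e
... | no  _   = refl

-- rounds h k: how many elements suffice for k rounds of pivoting when one
-- round, started on h n elements, leaves n of them.
rounds : (ℕ → ℕ) → ℕ → ℕ
rounds h zero    = 0
rounds h (suc k) = suc (h (rounds h k))

-- Each round takes the pivot e of the current set,
-- attaches data d : D e to it and shrinks the elements after e to a subset
-- on which Φ e d holds (Φ e d is a property of sets, inherited by subsets).
module Pivoting {m : ℕ} (O : PivotOrder m) (D : Fin m → Set)
                (Φ : (e : Fin m) → D e → (Fin m → Set) → Set)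
                (Φ-mono : ∀ {e d} {P Q : Fin m → Set} → (∀ x → P x → Q x) → Φ e d Q → Φ e d P) where
  open PivotOrder O

  After : Subset m → Fin m → Fin m → Set
  After X e x = x ∈ X × e ◁ x

  record Pivoted (S : Subset m) (k : ℕ) : Set where
    field
      chosen   : Subset m
      chosen⊆S : chosen ⊆ S
      many     : k ≤ ∣ chosen ∣
      choice   : (e : Fin m) → D e
      valid    : ∀ e → e ∈ chosen → Φ e (choice e) (After chosen e)

  weaken : ∀ {S T k} → S ⊆ T → Pivoted S k → Pivoted T k
  weaken S⊆T P = record
    { chosen = chosen ; chosen⊆S = λ x x∈ → S⊆T x (chosen⊆S x x∈) ; many = many ; choice = choice ; valid = valid }
    where open Pivoted P

  addPivot : ∀ {S k} e (dₑ : D e) → (∀ x → x ∈ S → e ◁ x) → Φ e dₑ (_∈ S) →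
             Pivoted S k → Pivoted (insert e S) (suc k)
  addPivot {S} {k} e dₑ e◁S Φₑ P = record
    { chosen = X ; chosen⊆S = X⊆ ; many = X-size ; choice = d ; valid = X-valid }
    where
    open Pivoted P renaming (chosen to X'; chosen⊆S to X'⊆S; many to X'-many; choice to d'; valid to X'-valid)
    e◁X' : ∀ x → x ∈ X' → e ◁ x
    e◁X' x x∈ = e◁S x (X'⊆S x x∈)
    X : Subset m
    X = insert e X'
    X⊆ : X ⊆ insert e S
    X⊆ x x∈ with ∈-insert⁻ X' e x x∈
    ... | inj₁ x∈X' = ∈-insert-there S e x (X'⊆S x x∈X')
    ... | inj₂ refl = ∈-insert-here S e
    X-size : suc k ≤ ∣ X ∣
    X-size = ≤-trans (s≤s X'-many) (≤-reflexive (sym (count-insert X' e λ e∈X' → ◁-asym (e◁X' e e∈X') (e◁X' e e∈X'))))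
    d : (x : Fin m) → D x
    d = update d' e dₑ
    X-valid : ∀ x → x ∈ X → Φ x (d x) (After X x)
    X-valid x x∈ with ∈-insert⁻ X' e x x∈
    ... | inj₂ refl = subst (λ d → Φ e d (After X e)) (sym (update-≡ d' e dₑ)) (Φ-mono afterPivot Φₑ)
      where
      afterPivot : ∀ y → After X e y → y ∈ S
      afterPivot y (y∈X , e◁y) with ∈-insert⁻ X' e y y∈X
      ... | inj₁ y∈X' = X'⊆S y y∈X'
      ... | inj₂ refl = contradiction e◁y (◁-asym e◁y)
    ... | inj₁ x∈X' = subst (λ d → Φ x d (After X x)) (sym (update-≢ d' e dₑ x≢e)) (Φ-mono afterLater (X'-valid x x∈X'))
      where
      x≢e : x ≢ e
      x≢e refl = ◁-asym (e◁X' e x∈X') (e◁X' e x∈X')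
      afterLater : ∀ y → After X x y → After X' x y
      afterLater y (y∈X , x◁y) with ∈-insert⁻ X' e y y∈X
      ... | inj₁ y∈X' = y∈X' , x◁y
      ... | inj₂ refl = contradiction (e◁X' x x∈X') (◁-asym x◁y)

  module _ (U : Subset m) (default : (e : Fin m) → D e) (h : ℕ → ℕ)
           (round : ∀ n e (S₀ : Subset m) → e ∈ U → S₀ ⊆ U → (∀ x → x ∈ S₀ → e ◁ x) → h n ≤ ∣ S₀ ∣ →
                    Σ (Subset m) λ S' → S' ⊆ S₀ × n ≤ ∣ S' ∣ × Σ (D e) λ d → Φ e d (_∈ S'))
    where

    iterate : ∀ k (S : Subset m) → S ⊆ U → rounds h k ≤ ∣ S ∣ → Pivoted S k
    iterate zero S _ _ = record
      { chosen = λ _ → false ; chosen⊆S = λ _ () ; many = z≤n ; choice = default ; valid = λ _ () }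
    iterate (suc k) S S⊆U big
      with pivot S (proj₂ (count-witness S (≤-trans (s≤s z≤n) big)))
    ... | e , e∈S , e◁S
      with round (rounds h k) e (S - e) (S⊆U e e∈S) S₀⊆U e◁S₀ (≤-pred (≤-trans big (count-remove S e)))
      where
      S₀⊆U : S - e ⊆ U
      S₀⊆U x x∈ = S⊆U x (proj₁ (∈-remove⁻ S e x x∈))
      e◁S₀ : ∀ x → x ∈ S - e → e ◁ x
      e◁S₀ x x∈ = let (x∈S , x≢e) = ∈-remove⁻ S e x x∈ in e◁S x x∈S x≢e
    ... | S' , S'⊆S₀ , S'-big , dₑ , Φₑ =
      weaken insert⊆S (addPivot e dₑ e◁S' Φₑ (iterate k S' S'⊆U S'-big))
      where
      S'⊆S : ∀ x → x ∈ S' → x ∈ S × x ≢ e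
      S'⊆S x x∈ = ∈-remove⁻ S e x (S'⊆S₀ x x∈)
      S'⊆U : S' ⊆ U
      S'⊆U x x∈ = S⊆U x (proj₁ (S'⊆S x x∈))
      e◁S' : ∀ x → x ∈ S' → e ◁ x
      e◁S' x x∈ = e◁S x (proj₁ (S'⊆S x x∈)) (proj₂ (S'⊆S x x∈))
      insert⊆S : insert e S' ⊆ S
      insert⊆S x x∈ with ∈-insert⁻ S' e x x∈
      ... | inj₁ x∈S' = proj₁ (S'⊆S x x∈S')
      ... | inj₂ refl = e∈S

module Selection {m : ℕ} (O : PivotOrder m) (V : Fin m → ℕ)
  (Good : (e : Fin m) → Fin (V e) → Fin m → Bool) (L : ℕ) .{{_ : NonZero L}} (U : Subset m)
  (nonempty : ∀ e → e ∈ U → 0 ℕ.< V e)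
  (dense : ∀ e c → e ∈ U → c ∈ U → PivotOrder._◁_ O e c → V e ≤ L * count (V e) (λ v → Good e v c))
  where

  GoodFor : (e : Fin m) → Pick (V e) → (Fin m → Set) → Set
  GoodFor e v P = ∀ c → P c → (p : 0 ℕ.< V e) → Good e (v p) c ≡ true

  open Pivoting O (Pick ∘ V) GoodFor (λ P⊆Q good c Pc → good c (P⊆Q c Pc)) public

  select : ∀ k (S : Subset m) → S ⊆ U → rounds (L *_) k ≤ ∣ S ∣ → Pivoted S k
  select = iterate U (λ _ → anyVertex) (L *_) round
    where
    round : ∀ n e (S₀ : Subset m) → e ∈ U → S₀ ⊆ U → (∀ x → x ∈ S₀ → PivotOrder._◁_ O e x) → L * n ≤ ∣ S₀ ∣ →
            Σ (Subset m) λ S' → S' ⊆ S₀ × n ≤ ∣ S' ∣ × Σ (Pick (V e)) λ v → GoodFor e v (_∈ S')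
    round n e S₀ e∈U S₀⊆U e◁S₀ big =
      let (v , v-good) = averaging L (nonempty e e∈U) S₀ (Good e)
                         (λ c c∈ → dense e c e∈U (S₀⊆U c c∈) (e◁S₀ c c∈))
      in (λ c → S₀ c ∧ Good e v c) , (λ c c∈ → BoolP.∧-conicalˡ _ _ c∈) ,
         *-cancelˡ-≤ L (≤-trans big v-good) , (λ _ → v) , (λ c c∈ _ → BoolP.∧-conicalʳ (S₀ c) _ c∈)

ℕ→ℚ-toℚᵘ : ∀ n → toℚᵘ (ℕ→ℚ n) ≡ mkℚᵘ (ℤ.+ n) 0
ℕ→ℚ-toℚᵘ n = cong toℚᵘ (ℚP.fromℚᵘ-toℚᵘ (mkℚ (ℤ.+ n) 0 (coprime-sym (1-coprimeTo n))))

-- A positive density can be traded for an integer constant: for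
-- μ = (a+1)/(d+1), μ·n ≤ e implies n ≤ (a+1)·n ≤ (d+1)·e.
densityConstant : (μ : ℚ) → 0ℚ <ℚ μ → Σ ℕ λ K → ∀ n e → μ *ℚ ℕ→ℚ n ≤ℚ ℕ→ℚ e → n ≤ suc K * e
densityConstant μ@(mkℚ +[1+ a ] d _) _ = d , bound
  where
  bound : ∀ n e → μ *ℚ ℕ→ℚ n ≤ℚ ℕ→ℚ e → n ≤ suc d * e
  bound n e μn≤e = ≤-trans (m≤m+n n (a * n)) (cross-multiplied (unnormalised μn≤e))
    where
    unnormalised : μ *ℚ ℕ→ℚ n ≤ℚ ℕ→ℚ e → mkℚᵘ +[1+ a ] d ℚᵘ.* mkℚᵘ (ℤ.+ n) 0 ℚᵘ.≤ mkℚᵘ (ℤ.+ e) 0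
    unnormalised h = ℚᵘP.≤-respˡ-≃ μn≃ (subst (toℚᵘ (μ *ℚ ℕ→ℚ n) ℚᵘ.≤_) (ℕ→ℚ-toℚᵘ e) (ℚP.toℚᵘ-mono-≤ h))
      where
      μn≃ : toℚᵘ (μ *ℚ ℕ→ℚ n) ℚᵘ.≃ mkℚᵘ +[1+ a ] d ℚᵘ.* mkℚᵘ (ℤ.+ n) 0
      μn≃ = ℚᵘP.≃-trans (ℚP.toℚᵘ-homo-* μ (ℕ→ℚ n)) (ℚᵘP.≃-reflexive (cong (mkℚᵘ +[1+ a ] d ℚᵘ.*_) (ℕ→ℚ-toℚᵘ n)))
    cross-multiplied : mkℚᵘ +[1+ a ] d ℚᵘ.* mkℚᵘ (ℤ.+ n) 0 ℚᵘ.≤ mkℚᵘ (ℤ.+ e) 0 → suc a * n ≤ suc d * e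
    cross-multiplied (*≤* ineq) = subst₂ _≤_ (*-identityʳ (suc a * n)) e[d+1]≡[d+1]e (ℤP.drop‿+≤+ (subst₂ ℤ._≤_ lhs rhs ineq))
      where
      lhs : +[1+ a ] ℤ.* ℤ.+ n ℤ.* ℤ.+ 1 ≡ ℤ.+ (suc a * n * 1)
      lhs = trans (cong (ℤ._* ℤ.+ 1) (sym (ℤP.pos-* (suc a) n))) (sym (ℤP.pos-* (suc a * n) 1))
      rhs : ℤ.+ e ℤ.* ℤ.+ (suc d * 1) ≡ ℤ.+ (e * (suc d * 1))
      rhs = sym (ℤP.pos-* e (suc d * 1))
      e[d+1]≡[d+1]e : e * (suc d * 1) ≡ suc d * e
      e[d+1]≡[d+1]e = trans (cong (e *_) (*-identityʳ (suc d))) (*-comm e (suc d))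
densityConstant (mkℚ (ℤ.+ zero) _ _) (*<* (ℤ.+<+ ()))
densityConstant (mkℚ -[1+ _ ]   _ _) (*<* ())

≤?-sound : ∀ {a b} → ⌊ a ≤? b ⌋ ≡ true → a ≤ b
≤?-sound {a} {b} h with a ≤? b
... | yes a≤b = a≤b

whenNonEmpty : (n : ℕ) → (.(0 ℕ.< n) → Bool) → Bool
whenNonEmpty zero    b = false
whenNonEmpty (suc n) b = b (s≤s z≤n)

whenNonEmpty-≡ : ∀ n (b : .(0 ℕ.< n) → Bool) (p : 0 ℕ.< n) → whenNonEmpty n b ≡ b p
whenNonEmpty-≡ (suc n) b p = refl

redBlueBound : ℕ → ℕ → ℕ
redBlueBound K = rounds (λ n → rounds (L *_) (rounds (L *_) n))
  where L = 2 * (2 * K)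

indexBound : ℕ → ℕ → ℕ
indexBound K f = rounds (rounds ((2 * K) *_)) (redBlueBound K f)

RainbowSequence : ∀ {m} → ReducedHypergraph m → ℕ → Set
RainbowSequence {m} A f =
  Σ (Fin f → Fin m) λ λ′ →
    (∀ r s → r < s → λ′ r < λ′ s) ×
    Σ (∀ r s → r < s → Fin (size A (λ′ r) (λ′ s))) λ red →
    Σ (∀ r s → r < s → Fin (size A (λ′ r) (λ′ s))) λ blue →
    Σ (∀ r s → r < s → Fin (size A (λ′ r) (λ′ s))) λ green →
      ∀ r s t → (p : r < s) → (q : s < t) →
        edge A (λ′ r) (λ′ s) (λ′ t) (red r s p) (blue r t (<-trans p q)) (green s t q) ≡ true

module Construction {m : ℕ} (A : ReducedHypergraph m) (K : ℕ) .{{_ : NonZero K}}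
  (dense : ∀ i j k → i < j → j < k → size A i j * size A i k * size A j k ≤ K * edgeCount A i j k)
  where

  instance
    2K-nonZero : NonZero (2 * K)
    2K-nonZero = m*n≢0 2 K

  degree : (r s t : Fin m) → Fin (size A s t) → ℕ
  degree r s t z = sumFin (size A r t) λ y → count (size A r s) λ x → edge A r s t x y z

  heavy : (r s t : Fin m) → Fin (size A s t) → Bool
  heavy r s t z = ⌊ size A r s * size A r t ≤? (2 * K) * degree r s t z ⌋

  edgeCount-by-degree : ∀ r s t → edgeCount A r s t ≡ sumFin (size A s t) (degree r s t)
  edgeCount-by-degree r s t = begin
    sumFin a (λ x → sumFin b (λ y → sumFin c (λ z → 𝟙 (edge A r s t x y z))))
      ≡⟨ sumFin-cong a (λ x → sumFin-comm b c _) ⟩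
    sumFin a (λ x → sumFin c (λ z → sumFin b (λ y → 𝟙 (edge A r s t x y z))))
      ≡⟨ sumFin-comm a c _ ⟩
    sumFin c (λ z → sumFin a (λ x → sumFin b (λ y → 𝟙 (edge A r s t x y z))))
      ≡⟨ sumFin-cong c (λ z → sumFin-comm a b _) ⟩
    sumFin c (degree r s t) ∎
    where
    open ≡-Reasoning
    a = size A r s
    b = size A r t
    c = size A s t

  many-heavy-vertices : ∀ r s t → r < s → s < t → size A s t ≤ (2 * K) * count (size A s t) (heavy r s t)
  many-heavy-vertices r s t r<s s<t =
    many-heavy (size A s t) (degree r s t) (size A r s * size A r t) K {{nonZero}} degree≤
      (≤-trans (dense r s t r<s s<t) (≤-reflexive (cong (K *_) (edgeCount-by-degree r s t))))
    where
    nonZero : NonZero (size A r s * size A r t)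
    nonZero = m*n≢0 _ _ {{>-nonZero (nonempty A r s r<s)}} {{>-nonZero (nonempty A r t (<-trans r<s s<t))}}
    degree≤ : ∀ z → degree r s t z ≤ size A r s * size A r t
    degree≤ z = ≤-trans (sumFin-mono (size A r t) (λ y → count-≤ (size A r s) _))
                        (≤-reflexive (trans (sumFin-const (size A r t) (size A r s)) (*-comm (size A r t) _)))

  GreenAt : Fin m → Set
  GreenAt t = (s : Fin m) → Pick (size A s t)

  HeavyOn : (t : Fin m) → GreenAt t → (Fin m → Set) → Set
  HeavyOn t g P = ∀ r s → P r → P s → r < s → (p : 0 ℕ.< size A s t) → heavy r s t (g s p) ≡ true

  module Green = Pivoting descending GreenAt HeavyOn (λ P⊆Q heavy r s Pr Ps → heavy r s (P⊆Q r Pr) (P⊆Q s Ps))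

  green : ∀ k → rounds (rounds ((2 * K) *_)) k ≤ m → Green.Pivoted (λ _ → true) k
  green k big = Green.iterate all (λ _ _ → anyVertex) (rounds ((2 * K) *_)) round k all (λ _ x → x)
                  (subst (_ ≤_) (sym (count-all m)) big)
    where
    all : Subset m
    all _ = true
    round : ∀ n t (S₀ : Subset m) → t ∈ all → S₀ ⊆ all → (∀ x → x ∈ S₀ → x < t) →
            rounds ((2 * K) *_) n ≤ ∣ S₀ ∣ →
            Σ (Subset m) λ S' → S' ⊆ S₀ × n ≤ ∣ S' ∣ × Σ (GreenAt t) λ g → HeavyOn t g (_∈ S')
    round n t S₀ _ _ S₀<t big =
      chosen , chosen⊆S , many , choice , λ r s r∈ s∈ r<s → valid s s∈ r (r∈ , r<s)
      where
      module Sel = Selection descending (λ s → size A s t) (λ s z r → heavy r s t z) (2 * K) S₀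
                     (λ s s∈ → nonempty A s t (S₀<t s s∈))
                     (λ s r s∈ _ r<s → many-heavy-vertices r s t r<s (S₀<t s s∈))
      open Sel.Pivoted (Sel.select n S₀ (λ _ x → x) big)

  module RedBlue {S : Subset m} {k : ℕ} (greenSet : Green.Pivoted S k) where
    open Green.Pivoted greenSet renaming (chosen to T; choice to G; valid to G-valid)

    L : ℕ
    L = 2 * (2 * K)

    instance
      L-nonZero : NonZero L
      L-nonZero = m*n≢0 2 (2 * K)

    heavy-green : ∀ r s t → r ∈ T → s ∈ T → t ∈ T → r < s → s < t →
                  (p : 0 ℕ.< size A s t) → heavy r s t (G t s p) ≡ true
    heavy-green r s t r∈ s∈ t∈ r<s s<t = G-valid t t∈ r s (r∈ , <-trans r<s s<t) (s∈ , s<t) r<s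

    BlueGood : (r t : Fin m) → Fin (size A r t) → Fin m → Bool
    BlueGood r t b s = whenNonEmpty (size A s t) λ q →
      ⌊ size A r s ≤? L * count (size A r s) (λ x → edge A r s t x b (G t s q)) ⌋

    many-blue-good : ∀ r s t → r ∈ T → s ∈ T → t ∈ T → r < s → s < t →
                     size A r t ≤ L * count (size A r t) (λ b → BlueGood r t b s)
    many-blue-good r s t r∈ s∈ t∈ r<s s<t =
      subst (λ c → size A r t ≤ L * c) (sumFin-cong (size A r t) (λ b → cong 𝟙 (sym (whenNonEmpty-≡ _ _ q))))
        (many-heavy (size A r t) (λ b → count (size A r s) (λ x → edge A r s t x b (G t s q))) (size A r s) (2 * K)
           {{>-nonZero (nonempty A r s r<s)}} (λ b → count-≤ (size A r s) _) (≤?-sound (heavy-green r s t r∈ s∈ t∈ r<s s<t q)))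
      where
      q : 0 ℕ.< size A s t
      q = nonempty A s t s<t

    RedGood : (r : Fin m) → ((j : Fin m) → Pick (size A r j)) → (s : Fin m) → Fin (size A r s) → Fin m → Bool
    RedGood r bl s a t = whenNonEmpty (size A r t) λ q → whenNonEmpty (size A s t) λ q' →
      edge A r s t a (bl t q) (G t s q')

    many-red-good : ∀ r s t (bl : (j : Fin m) → Pick (size A r j)) → (p : 0 ℕ.< size A r t) → s < t →
                    BlueGood r t (bl t p) s ≡ true → size A r s ≤ L * count (size A r s) (λ a → RedGood r bl s a t)
    many-red-good r s t bl p s<t blue-good =
      subst (λ c → size A r s ≤ L * c)
        (sumFin-cong (size A r s) (λ a → cong 𝟙 (sym (trans (whenNonEmpty-≡ _ _ p) (whenNonEmpty-≡ _ _ q)))))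
        (≤?-sound (trans (sym (whenNonEmpty-≡ _ _ q)) blue-good))
      where
      q : 0 ℕ.< size A s t
      q = nonempty A s t s<t

    RedBlueAt : Fin m → Set
    RedBlueAt r = ((j : Fin m) → Pick (size A r j)) × ((j : Fin m) → Pick (size A r j))

    EdgesOn : (r : Fin m) → RedBlueAt r → (Fin m → Set) → Set
    EdgesOn r (rd , bl) P = ∀ j l → P j → P l → j < l →
      (p : 0 ℕ.< size A r j) (q : 0 ℕ.< size A r l) (p' : 0 ℕ.< size A j l) →
      edge A r j l (rd j p) (bl l q) (G l j p') ≡ true

    module Rainbow = Pivoting ascending RedBlueAt EdgesOn
      (λ P⊆Q edges j l Pj Pl → edges j l (P⊆Q j Pj) (P⊆Q l Pl))

    redBlue : ∀ f → redBlueBound K f ≤ ∣ T ∣ → Rainbow.Pivoted T f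
    redBlue f big = Rainbow.iterate T (λ _ → (λ _ → anyVertex) , (λ _ → anyVertex))
                      (λ n → rounds (L *_) (rounds (L *_) n)) round f T (λ _ x → x) big
      where
      round : ∀ n r (S₀ : Subset m) → r ∈ T → S₀ ⊆ T → (∀ x → x ∈ S₀ → r < x) →
              rounds (L *_) (rounds (L *_) n) ≤ ∣ S₀ ∣ →
              Σ (Subset m) λ S' → S' ⊆ S₀ × n ≤ ∣ S' ∣ × Σ (RedBlueAt r) λ d → EdgesOn r d (_∈ S')
      round n r S₀ r∈T S₀⊆T r<S₀ big =
        S₂ , (λ x x∈ → S₁⊆S₀ x (S₂⊆S₁ x x∈)) , S₂-many , (rd , bl) , edges
        where
        module Blue = Selection descending (size A r) (λ t b s → BlueGood r t b s) L S₀
                        (λ t t∈ → nonempty A r t (r<S₀ t t∈))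
                        (λ t s t∈ s∈ s<t → many-blue-good r s t r∈T (S₀⊆T s s∈) (S₀⊆T t t∈) (r<S₀ s s∈) s<t)
        open Blue.Pivoted (Blue.select (rounds (L *_) n) S₀ (λ _ x → x) big)
          renaming (chosen to S₁; chosen⊆S to S₁⊆S₀; many to S₁-many; choice to bl; valid to bl-valid)
        red-dense : ∀ s t → s ∈ S₁ → t ∈ S₁ → s < t →
                    size A r s ≤ L * count (size A r s) (λ a → RedGood r bl s a t)
        red-dense s t s∈ t∈ s<t = many-red-good r s t bl p s<t (bl-valid t t∈ s (s∈ , s<t) p)
          where p = nonempty A r t (r<S₀ t (S₁⊆S₀ t t∈))
        module Red = Selection ascending (size A r) (λ s a t → RedGood r bl s a t) L S₁
                       (λ s s∈ → nonempty A r s (r<S₀ s (S₁⊆S₀ s s∈))) red-dense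
        open Red.Pivoted (Red.select n S₁ (λ _ x → x) S₁-many)
          renaming (chosen to S₂; chosen⊆S to S₂⊆S₁; many to S₂-many; choice to rd; valid to rd-valid)
        edges : EdgesOn r (rd , bl) (_∈ S₂)
        edges j l j∈ l∈ j<l p q p' =
          trans (sym (trans (whenNonEmpty-≡ _ _ q) (whenNonEmpty-≡ _ _ p'))) (rd-valid j j∈ l (l∈ , j<l) p)

  rainbow : ∀ f → indexBound K f ≤ m → RainbowSequence A f
  rainbow f big =
    let (λ′ , increasing , λ′∈X) = enumerate f chosen many
        nonempty′ : ∀ r s → r < s → 0 ℕ.< size A (λ′ r) (λ′ s)
        nonempty′ r s r<s = nonempty A _ _ (increasing r s r<s)
    in λ′ , increasing ,
       (λ r s r<s → proj₁ (choice (λ′ r)) (λ′ s) (nonempty′ r s r<s)) ,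
       (λ r s r<s → proj₂ (choice (λ′ r)) (λ′ s) (nonempty′ r s r<s)) ,
       (λ r s r<s → G (λ′ s) (λ′ r) (nonempty′ r s r<s)) ,
       λ r s t r<s s<t → valid (λ′ r) (λ′∈X r) (λ′ s) (λ′ t)
         (λ′∈X s , increasing r s r<s) (λ′∈X t , increasing r t (<-trans r<s s<t)) (increasing s t s<t)
         (nonempty′ r s r<s) (nonempty′ r t (<-trans r<s s<t)) (nonempty′ s t s<t)
    where
    greenSet : Green.Pivoted (λ _ → true) (redBlueBound K f)
    greenSet = green (redBlueBound K f) big
    open Green.Pivoted greenSet using () renaming (choice to G; many to T-many)
    open RedBlue greenSet using (module Rainbow; redBlue)
    open Rainbow.Pivoted (redBlue f T-many)

lemma3p1 : (μ : ℚ) → 0ℚ <ℚ μ → (f : ℕ) →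
    ∃ λ (m : ℕ) → (A : ReducedHypergraph m) → Dense μ A →
      Σ (Fin f → Fin m) λ λ′ →
        (∀ r s → r < s → λ′ r < λ′ s) ×
        Σ (∀ r s → r < s → Fin (size A (λ′ r) (λ′ s))) λ red →
        Σ (∀ r s → r < s → Fin (size A (λ′ r) (λ′ s))) λ blue →
        Σ (∀ r s → r < s → Fin (size A (λ′ r) (λ′ s))) λ green →
          ∀ r s t → (p : r < s) → (q : s < t) →
            edge A (λ′ r) (λ′ s) (λ′ t) (red r s p) (blue r t (<-trans p q)) (green s t q) ≡ true
lemma3p1 μ μ>0 f with densityConstant μ μ>0
... | K , scale = indexBound (suc K) f , λ A A-dense →
  Construction.rainbow A (suc K) (λ i j k i<j j<k → scale _ _ (A-dense i j k i<j j<k)) f ≤-refl
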